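{- Let $P$ be a finite poset on ground set $I$, and let $Q$ be a good fracturing of $P$. Then a set composition $\Phi\models I$ belongs to $\mathrm{Supp}(Q)$ if and only if all of the following hold: (i) for all $i,j\in Q$: if $j<_Q i$ then $i=_\Phi j$; (ii) for all $i,j\in Q$: if $j<_P i$ and $j\not<_Q i$ then $i<_\Phi j$; (iii) for all $i\in Q$ and $j\in P\setminus Q$: if $j<_P i$ then $i<_\Phi j$; (iv) for every $b\in P\setminus Q$ there exists $a\in P$ with $a<_P b$ and $a<_\Phi b$.
   Context: For a finite set $I$, a set composition $\Phi=\Phi_1|\cdots|\Phi_m\models I$ is an ordered partition of $I$ into nonempty blocks; for $i\in\Phi_a,j\in\Phi_b$ write $i<_\Phi j$, $i=_\Phi j$ according as $a<b$, $a=b$. For a grounded set family $(\mathcal{F},I)$ ($\emptyset\in\mathcal{F}\subseteq 2^I$) let $\mathcal{F}_i=\{A\cap\Phi_i:A\in\mathcal{F},\ A\cap\Phi_j=\emptyset\ \forall j<i\}$ and $\mu_\Phi\Delta_\Phi(\mathcal{F})=\mathcal{F}_1*\cdots*\mathcal{F}_m=\{X_1\cup\cdots\cup X_m: X_i\in\mathcal{F}_i\}$. $J(P)$ is the family of order ideals of $P$. A fracturing of $P$ is a poset $Q$ whose underlying set is a (not necessarily proper) subset of $P$ and which is a disjoint union of induced subposets of $P$ (so $x<_Q y$ iff $x,y$ lie in the same summand and $x<_P y$). The support system of $Q$ is $\mathrm{Supp}(Q)=\{\Phi\models I: \mu_\Phi\Delta_\Phi(J(P))=J(Q)\}$, and $Q$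 is good if $\mathrm{Supp}(Q)\neq\emptyset$. -}

module Defs where

open import Level using (0ℓ)
open import Data.Nat using (ℕ)
open import Data.Fin using (Fin; _<_; _≥_; _≟_)
open import Data.Fin.Subset using (Subset; _∈_; _∉_; _∩_; ⋃)
open import Data.Vec using (tabulate)
open import Data.List using (List)
import Data.List as List
open import Data.Product using (Σ; ∃; ∃-syntax; _×_; _,_)
open import Relation.Nullary using (¬_; Dec; ⌊_⌋)
open import Relation.Binary.PropositionalEquality using (_≡_)
open import Relation.Binary.Definitions using (Decidable)
open import Relation.Binary.Structures using (IsStrictPartialOrder)

-- A finite poset P on the ground set I = Fin n, given by its strict order.
-- (Decidability of the order is automatic for a finite poset classically;
-- we record it to allow constructive reasoning.)
record FinPoset (n : ℕ) : Set₁ where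
  field
    _<P_  : Fin n → Fin n → Set
    isSPO : IsStrictPartialOrder _≡_ _<P_
    _<P?_ : Decidable _<P_
open FinPoset public

-- A set composition Φ = Φ₁|…|Φₘ ⊨ Fin n, encoded as the block-index map
-- Φ : Fin n → Fin m (x ∈ Φ_a iff Φ x ≡ a); blocks nonempty = surjective.
IsSetComposition : ∀ {n m} → (Fin n → Fin m) → Set
IsSetComposition {n} {m} Φ = ∀ (a : Fin m) → ∃[ x ] (Φ x ≡ a)

_<[_]_ : ∀ {n m} → Fin n → (Fin n → Fin m) → Fin n → Set
i <[ Φ ] j = Φ i < Φ j

_=[_]_ : ∀ {n m} → Fin n → (Fin n → Fin m) → Fin n → Set
i =[ Φ ] j = Φ i ≡ Φ j

Family : ℕ → Set₁
Family n = Subset n → Set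

_≐_ : ∀ {n} → Family n → Family n → Set
F ≐ G = ∀ X → (F X → G X) × (G X → F X)

block : ∀ {n m} → (Fin n → Fin m) → Fin m → Subset n
block Φ a = tabulate (λ x → ⌊ Φ x ≟ a ⌋)

-- F_a = { A ∩ Φ_a : A ∈ F, A ∩ Φ_b = ∅ for all b < a }
restrict : ∀ {n m} → (Fin n → Fin m) → Family n → Fin m → Family n
restrict Φ F a X =
  ∃[ A ] (F A × (∀ x → x ∈ A → Φ x ≥ a) × X ≡ A ∩ block Φ a)

-- μ_Φ Δ_Φ (F) = F₁ * ⋯ * Fₘ = { X₁ ∪ ⋯ ∪ Xₘ : X_a ∈ F_a }
μΔ : ∀ {n m} → (Fin n → Fin m) → Family n → Family n
μΔ {n} {m} Φ F X =
  ∃[ Xs ] ((∀ a → restrict Φ F a (Xs a)) × X ≡ ⋃ (List.tabulate Xs))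

J : ∀ {n} → FinPoset n → Family n
J P A = ∀ x y → _<P_ P y x → x ∈ A → y ∈ A

-- A fracturing Q of P: an underlying subset of P and a labelling of its
-- elements by summand; Q is the disjoint union of the induced subposets
-- of P on the summands.
record Fracturing (n : ℕ) : Set where
  field
    carrier : Subset n
    summand : Fin n → ℕ
open Fracturing public

_<Q[_,_]_ : ∀ {n} → Fin n → FinPoset n → Fracturing n → Fin n → Set
x <Q[ P , Q ] y =
  x ∈ carrier Q × y ∈ carrier Q × summand Q x ≡ summand Q y × _<P_ P x y

JQ : ∀ {n} → FinPoset n → Fracturing n → Family n
JQ P Q A = (∀ x → x ∈ A → x ∈ carrier Q)
         × (∀ x y → y <Q[ P , Q ] x → x ∈ A → y ∈ A)

InSupp : ∀ {n m} → FinPoset n → Fracturing n → (Fin n → Fin m) → Set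
InSupp P Q Φ = μΔ Φ (J P) ≐ JQ P Q

Good : ∀ {n} → FinPoset n → Fracturing n → Set
Good {n} P Q = ∃[ m ] ∃[ Φ ] (IsSetComposition {n} {m} Φ × InSupp P Q Φ)

Conditions : ∀ {n m} → FinPoset n → Fracturing n → (Fin n → Fin m) → Set
Conditions P Q Φ =
    (∀ i j → i ∈ carrier Q → j ∈ carrier Q →
       j <Q[ P , Q ] i → i =[ Φ ] j)
  × (∀ i j → i ∈ carrier Q → j ∈ carrier Q →
       _<P_ P j i → ¬ (j <Q[ P , Q ] i) → i <[ Φ ] j)
  × (∀ i j → i ∈ carrier Q → j ∉ carrier Q →
       _<P_ P j i → i <[ Φ ] j)
  × (∀ b → b ∉ carrier Q → ∃[ a ] (_<P_ P a b × a <[ Φ ] b))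

{-# OPTIONS --safe #-}
module Submission where

-- A set X lies in μ_Φ Δ_Φ (J P) exactly when it is a block ideal: every P-predecessor of an
-- element of X lies in the same or a later block of Φ, and lies in X when it is in the same
-- block. So Φ ∈ Supp(Q) says that block ideals and order ideals of Q coincide. Testing this
-- on principal Q-ideals and on principal P-ideals cut down to one block gives (i)–(iv);
-- conversely (i)–(iv) are what is needed to turn either kind of ideal into the other.

open import Defs
open import Level using (0ℓ)
open import Data.Nat using (ℕ)
import Data.Nat.Properties as ℕ
open import Data.Bool.Properties using (T-≡)
open import Data.Fin using (Fin; zero; suc; _≤_; _≟_; _<?_)
open import Data.Fin.Properties using (any?; ≤-refl; ≤-reflexive; <⇒≢; ≤∧≢⇒<)
open import Data.Fin.Subset using (Subset; _∈_; _∉_; _∩_; ⋃; ⁅_⁆; _⊆_)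
open import Data.Fin.Subset.Properties
  using (_∈?_; x∈p∩q⁺; x∈p∩q⁻; x∈p∪q⁺; x∈p∪q⁻; ∉⊥; ⊆-antisym; x∈⁅x⁆; x∈⁅y⁆⇒x≡y)
open import Data.Vec using (tabulate)
open import Data.Vec.Properties using (lookup∘tabulate; []=⇒lookup; lookup⇒[]=)
import Data.List as List
open import Data.Product using (∃-syntax; _×_; _,_; proj₁; proj₂)
open import Data.Sum using (_⊎_; inj₁; inj₂)
open import Data.Empty using (⊥-elim)
open import Function using (_∘_)
open import Function.Bundles using (Equivalence)
open import Relation.Nullary using (¬_; yes; no; ⌊_⌋)
open import Relation.Nullary.Decidable using (_×-dec_; _⊎-dec_; toWitness; fromWitness)
open import Relation.Unary using (Pred)
import Relation.Unary as U
open import Relation.Binary using (Rel; Transitive)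
import Relation.Binary as B
open import Relation.Binary.PropositionalEquality using (_≡_; refl; sym; trans; subst)
open import Relation.Binary.Structures using (IsStrictPartialOrder)

module _ {n} {Pr : Pred (Fin n) 0ℓ} (Pr? : U.Decidable Pr) where

  subset : Subset n
  subset = tabulate (λ x → ⌊ Pr? x ⌋)

  ∈-subset⁺ : ∀ {x} → Pr x → x ∈ subset
  ∈-subset⁺ {x} px = lookup⇒[]= x subset
    (trans (lookup∘tabulate _ x) (Equivalence.to T-≡ (fromWitness px)))

  ∈-subset⁻ : ∀ {x} → x ∈ subset → Pr x
  ∈-subset⁻ {x} x∈ = toWitness (Equivalence.from T-≡
    (trans (sym (lookup∘tabulate _ x)) ([]=⇒lookup x∈)))

∈-block⁺ : ∀ {n m} (Φ : Fin n → Fin m) {x a} → Φ x ≡ a → x ∈ block Φ a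
∈-block⁺ Φ {a = a} = ∈-subset⁺ (λ y → Φ y ≟ a)

∈-block⁻ : ∀ {n m} (Φ : Fin n → Fin m) {x a} → x ∈ block Φ a → Φ x ≡ a
∈-block⁻ Φ {a = a} = ∈-subset⁻ (λ y → Φ y ≟ a)

∈-⋃-tabulate⁺ : ∀ {n m} (Xs : Fin m → Subset n) {x} a → x ∈ Xs a → x ∈ ⋃ (List.tabulate Xs)
∈-⋃-tabulate⁺ Xs zero    x∈ = x∈p∪q⁺ (inj₁ x∈)
∈-⋃-tabulate⁺ Xs (suc a) x∈ = x∈p∪q⁺ (inj₂ (∈-⋃-tabulate⁺ (Xs ∘ suc) a x∈))

∈-⋃-tabulate⁻ : ∀ {n m} (Xs : Fin m → Subset n) {x} → x ∈ ⋃ (List.tabulate Xs) → ∃[ a ] x ∈ Xs a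
∈-⋃-tabulate⁻ {m = ℕ.zero}  Xs x∈ = ⊥-elim (∉⊥ x∈)
∈-⋃-tabulate⁻ {m = ℕ.suc m} Xs x∈ with x∈p∪q⁻ (Xs zero) _ x∈
... | inj₁ x∈X₀ = zero , x∈X₀
... | inj₂ x∈⋃  with ∈-⋃-tabulate⁻ (Xs ∘ suc) x∈⋃
...   | a , x∈Xa = suc a , x∈Xa

module DownSet {n} (_≺_ : Rel (Fin n) 0ℓ) (_≺?_ : B.Decidable _≺_) (≺-trans : Transitive _≺_) where

  _≼_ : Rel (Fin n) 0ℓ
  y ≼ x = y ≡ x ⊎ y ≺ x

  ≺-≼-trans : ∀ {x y z} → z ≺ y → y ≼ x → z ≺ x
  ≺-≼-trans z≺y (inj₁ refl) = z≺y
  ≺-≼-trans z≺y (inj₂ y≺x)  = ≺-trans z≺y y≺x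

  ↓ : Subset n → Subset n
  ↓ S = subset (λ y → any? (λ x → (x ∈? S) ×-dec ((y ≟ x) ⊎-dec (y ≺? x))))

  ∈-↓⁺ : ∀ {S x y} → x ∈ S → y ≼ x → y ∈ ↓ S
  ∈-↓⁺ x∈S y≼x = ∈-subset⁺ _ (_ , x∈S , y≼x)

  ∈-↓⁻ : ∀ {S y} → y ∈ ↓ S → ∃[ x ] (x ∈ S × y ≼ x)
  ∈-↓⁻ = ∈-subset⁻ _

  ⊆-↓ : ∀ {S} → S ⊆ ↓ S
  ⊆-↓ x∈S = ∈-↓⁺ x∈S (inj₁ refl)

  ↓-closed : ∀ S x y → y ≺ x → x ∈ ↓ S → y ∈ ↓ S
  ↓-closed S x y y≺x x∈↓ with ∈-↓⁻ x∈↓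
  ... | z , z∈S , x≼z = ∈-↓⁺ z∈S (inj₂ (≺-≼-trans y≺x x≼z))

  ∈-↓⁅⁆⁻ : ∀ {c y} → y ∈ ↓ ⁅ c ⁆ → y ≼ c
  ∈-↓⁅⁆⁻ y∈ with ∈-↓⁻ y∈
  ... | x , x∈⁅c⁆ , y≼x with x∈⁅y⁆⇒x≡y _ x∈⁅c⁆
  ...   | refl = y≼x

module BlockIdeals {n m} (P : FinPoset n) (Φ : Fin n → Fin m) where
  open IsStrictPartialOrder (isSPO P) using () renaming (trans to <P-trans)
  open DownSet (_<P_ P) (_<P?_ P) <P-trans

  IsBlockIdeal : Subset n → Set
  IsBlockIdeal X = ∀ {x y} → x ∈ X → _<P_ P y x → Φ x ≤ Φ y × (Φ y ≡ Φ x → y ∈ X)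

  μΔ-J⇒isBlockIdeal : ∀ {X} → μΔ Φ (J P) X → IsBlockIdeal X
  μΔ-J⇒isBlockIdeal (Xs , restricted , refl) {x} {y} x∈X y<x
    with ∈-⋃-tabulate⁻ Xs x∈X
  ... | a , x∈Xa with restricted a
  ...   | A , A-ideal , A≥a , Xa≡ with x∈p∩q⁻ A (block Φ a) (subst (x ∈_) Xa≡ x∈Xa)
  ...     | x∈A , x∈block with ∈-block⁻ Φ x∈block
  ...       | refl = A≥a y y∈A , λ Φy≡Φx →
                ∈-⋃-tabulate⁺ Xs (Φ x) (subst (y ∈_) (sym Xa≡) (x∈p∩q⁺ (y∈A , ∈-block⁺ Φ Φy≡Φx)))
    where
    y∈A : y ∈ A
    y∈A = A-ideal x y y<x x∈A

  isBlockIdeal⇒μΔ-J : ∀ {X} → IsBlockIdeal X → μΔ Φ (J P) X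
  isBlockIdeal⇒μΔ-J {X} blockIdeal =
    Xs , (λ a → ↓ (X ∩ block Φ a) , ↓-closed _ , ↓-above a , refl) , ⊆-antisym X⊆⋃ ⋃⊆X
    where
    Xs : Fin m → Subset n
    Xs a = ↓ (X ∩ block Φ a) ∩ block Φ a

    ↓-above : ∀ a y → y ∈ ↓ (X ∩ block Φ a) → a ≤ Φ y
    ↓-above a y y∈↓ with ∈-↓⁻ y∈↓
    ... | x , x∈X∩a , y≼x with x∈p∩q⁻ X (block Φ a) x∈X∩a
    ...   | x∈X , x∈block with ∈-block⁻ Φ x∈block | y≼x
    ...     | refl | inj₁ refl = ≤-refl
    ...     | refl | inj₂ y<x  = proj₁ (blockIdeal x∈X y<x)

    X⊆⋃ : X ⊆ ⋃ (List.tabulate Xs)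
    X⊆⋃ {x} x∈X = ∈-⋃-tabulate⁺ Xs (Φ x)
      (x∈p∩q⁺ (⊆-↓ (x∈p∩q⁺ (x∈X , ∈-block⁺ Φ refl)) , ∈-block⁺ Φ refl))

    ⋃⊆X : ⋃ (List.tabulate Xs) ⊆ X
    ⋃⊆X {y} y∈⋃ with ∈-⋃-tabulate⁻ Xs y∈⋃
    ... | a , y∈Xa with x∈p∩q⁻ (↓ (X ∩ block Φ a)) (block Φ a) y∈Xa
    ...   | y∈↓ , y∈block with ∈-↓⁻ y∈↓
    ...     | x , x∈X∩a , y≼x with x∈p∩q⁻ X (block Φ a) x∈X∩a | y≼x
    ...       | x∈X , _       | inj₁ refl = x∈X
    ...       | x∈X , x∈block | inj₂ y<x  =
                proj₂ (blockIdeal x∈X y<x) (trans (∈-block⁻ Φ y∈block) (sym (∈-block⁻ Φ x∈block)))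

  principal : Fin n → Subset n
  principal c = ↓ ⁅ c ⁆ ∩ block Φ (Φ c)

  ∈-principal : ∀ c → c ∈ principal c
  ∈-principal c = x∈p∩q⁺ (⊆-↓ (x∈⁅x⁆ c) , ∈-block⁺ Φ refl)

  principal-sameBlock : ∀ {c y} → y ∈ principal c → Φ y ≡ Φ c
  principal-sameBlock {c} y∈ = ∈-block⁻ Φ (proj₂ (x∈p∩q⁻ (↓ ⁅ c ⁆) _ y∈))

  isBlockIdeal-principal : ∀ {c} → (∀ {y} → _<P_ P y c → Φ c ≤ Φ y) → IsBlockIdeal (principal c)
  isBlockIdeal-principal {c} Φc-minimal {x} {y} x∈ y<x with x∈p∩q⁻ (↓ ⁅ c ⁆) _ x∈
  ... | x∈↓c , x∈block = subst (_≤ Φ y) (sym Φx≡Φc) (Φc-minimal y<c) , λ Φy≡Φx →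
        x∈p∩q⁺ (∈-↓⁺ (x∈⁅x⁆ c) (inj₂ y<c) , ∈-block⁺ Φ (trans Φy≡Φx Φx≡Φc))
    where
    Φx≡Φc : Φ x ≡ Φ c
    Φx≡Φc = ∈-block⁻ Φ x∈block
    y<c : _<P_ P y c
    y<c = ≺-≼-trans y<x (∈-↓⁅⁆⁻ x∈↓c)

module Support {n m} (P : FinPoset n) (Q : Fracturing n) (Φ : Fin n → Fin m) where
  open IsStrictPartialOrder (isSPO P) using (irrefl) renaming (trans to <P-trans)
  open BlockIdeals P Φ

  C : Subset n
  C = carrier Q

  _<Q_ : Rel (Fin n) 0ℓ
  x <Q y = x <Q[ P , Q ] y

  _<Q?_ : B.Decidable _<Q_
  x <Q? y = (x ∈? C) ×-dec (y ∈? C) ×-dec (summand Q x ℕ.≟ summand Q y) ×-dec (_<P?_ P x y)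

  <Q-trans : Transitive _<Q_
  <Q-trans (x∈C , _ , s₁ , x<y) (_ , z∈C , s₂ , y<z) = x∈C , z∈C , trans s₁ s₂ , <P-trans x<y y<z

  <Q⇒<P : ∀ {x y} → x <Q y → _<P_ P x y
  <Q⇒<P (_ , _ , _ , x<y) = x<y

  module ↓Q = DownSet _<Q_ _<Q?_ <Q-trans

  JQ-↓Q⁅⁆ : ∀ {i} → i ∈ C → JQ P Q (↓Q.↓ ⁅ i ⁆)
  JQ-↓Q⁅⁆ {i} i∈C = ⊆C , ↓Q.↓-closed ⁅ i ⁆
    where
    ⊆C : ∀ x → x ∈ ↓Q.↓ ⁅ i ⁆ → x ∈ C
    ⊆C x x∈ with ↓Q.∈-↓⁅⁆⁻ x∈
    ... | inj₁ refl = i∈C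
    ... | inj₂ x<Qi = proj₁ x<Qi

  module FromSupport (supp : InSupp P Q Φ) where

    isBlockIdeal⇒JQ : ∀ {X} → IsBlockIdeal X → JQ P Q X
    isBlockIdeal⇒JQ {X} = proj₁ (supp X) ∘ isBlockIdeal⇒μΔ-J

    JQ⇒isBlockIdeal : ∀ {X} → JQ P Q X → IsBlockIdeal X
    JQ⇒isBlockIdeal {X} = μΔ-J⇒isBlockIdeal ∘ proj₂ (supp X)

    below-Q-element : ∀ {i j} → i ∈ C → _<P_ P j i → Φ i ≤ Φ j × (Φ j ≡ Φ i → j ↓Q.≼ i)
    below-Q-element {i} i∈C j<i with JQ⇒isBlockIdeal (JQ-↓Q⁅⁆ i∈C) (↓Q.⊆-↓ (x∈⁅x⁆ i)) j<i
    ... | Φi≤Φj , sameBlock⇒j∈↓i = Φi≤Φj , ↓Q.∈-↓⁅⁆⁻ ∘ sameBlock⇒j∈↓i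

    blockMinimal⇒∈C : ∀ {c} → (∀ {y} → _<P_ P y c → Φ c ≤ Φ y) → c ∈ C
    blockMinimal⇒∈C {c} Φc-minimal = proj₁ (isBlockIdeal⇒JQ (isBlockIdeal-principal Φc-minimal)) c (∈-principal c)

    <Q⇒=Φ : ∀ {i j} → j <Q i → i =[ Φ ] j
    <Q⇒=Φ {i} {j} j<Qi@(_ , i∈C , _) = sym (principal-sameBlock j∈principal)
      where
      j∈principal : j ∈ principal i
      j∈principal = proj₂ (isBlockIdeal⇒JQ (isBlockIdeal-principal (proj₁ ∘ below-Q-element i∈C)))
        i j j<Qi (∈-principal i)

    ≮Q⇒<Φ : ∀ {i j} → i ∈ C → _<P_ P j i → ¬ j <Q i → i <[ Φ ] j
    ≮Q⇒<Φ {i} {j} i∈C j<i j≮Qi with below-Q-element i∈C j<i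
    ... | Φi≤Φj , sameBlock⇒j≼i = ≤∧≢⇒< Φi≤Φj (λ Φi≡Φj → not-below (sameBlock⇒j≼i (sym Φi≡Φj)))
      where
      not-below : ¬ j ↓Q.≼ i
      not-below (inj₁ j≡i)  = irrefl j≡i j<i
      not-below (inj₂ j<Qi) = j≮Qi j<Qi

    conditions : Conditions P Q Φ
    conditions =
        (λ _ _ _ _ → <Q⇒=Φ)
      , (λ _ _ i∈C _ → ≮Q⇒<Φ i∈C)
      , (λ _ _ i∈C j∉C j<i → ≮Q⇒<Φ i∈C j<i (j∉C ∘ proj₁))
      , has-smaller-predecessor
      where
      has-smaller-predecessor : ∀ b → b ∉ C → ∃[ a ] (_<P_ P a b × a <[ Φ ] b)
      has-smaller-predecessor b b∉C with any? (λ a → _<P?_ P a b ×-dec (Φ a <? Φ b))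
      ... | yes found = found
      ... | no none   = ⊥-elim (b∉C (blockMinimal⇒∈C (λ {y} y<b → ℕ.≮⇒≥ (λ Φy<Φb → none (y , y<b , Φy<Φb)))))

  module FromConditions (conditions : Conditions P Q Φ) where

    same-block : ∀ i j → i ∈ C → j ∈ C → j <Q i → i =[ Φ ] j
    same-block = proj₁ conditions

    later-block : ∀ i j → i ∈ C → j ∈ C → _<P_ P j i → ¬ j <Q i → i <[ Φ ] j
    later-block = proj₁ (proj₂ conditions)

    later-block-outside : ∀ i j → i ∈ C → j ∉ C → _<P_ P j i → i <[ Φ ] j
    later-block-outside = proj₁ (proj₂ (proj₂ conditions))

    has-smaller-predecessor : ∀ b → b ∉ C → ∃[ a ] (_<P_ P a b × a <[ Φ ] b)
    has-smaller-predecessor = proj₂ (proj₂ (proj₂ conditions))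

    ≮Q⇒<Φ : ∀ {i j} → i ∈ C → _<P_ P j i → ¬ j <Q i → i <[ Φ ] j
    ≮Q⇒<Φ {i} {j} i∈C j<i j≮Qi with j ∈? C
    ... | yes j∈C = later-block i j i∈C j∈C j<i j≮Qi
    ... | no  j∉C = later-block-outside i j i∈C j∉C j<i

    isBlockIdeal⇒JQ : ∀ {X} → IsBlockIdeal X → JQ P Q X
    isBlockIdeal⇒JQ {X} blockIdeal = ⊆C , closed
      where
      ⊆C : ∀ x → x ∈ X → x ∈ C
      ⊆C x x∈X with x ∈? C
      ... | yes x∈C = x∈C
      ... | no  x∉C with has-smaller-predecessor x x∉C
      ...   | a , a<x , Φa<Φx = ⊥-elim (ℕ.<⇒≱ Φa<Φx (proj₁ (blockIdeal x∈X a<x)))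

      closed : ∀ x y → y <Q x → x ∈ X → y ∈ X
      closed x y y<Qx@(y∈C , x∈C , _) x∈X =
        proj₂ (blockIdeal x∈X (<Q⇒<P y<Qx)) (sym (same-block x y x∈C y∈C y<Qx))

    JQ⇒isBlockIdeal : ∀ {X} → JQ P Q X → IsBlockIdeal X
    JQ⇒isBlockIdeal (⊆C , closed) {x} {y} x∈X y<x with y <Q? x
    ... | yes y<Qx = ≤-reflexive (same-block x y (⊆C x x∈X) (proj₁ y<Qx) y<Qx) , λ _ → closed x y y<Qx x∈X
    ... | no  y≮Qx = ℕ.<⇒≤ Φx<Φy , λ Φy≡Φx → ⊥-elim (<⇒≢ Φx<Φy (sym Φy≡Φx))
      where
      Φx<Φy : x <[ Φ ] y
      Φx<Φy = ≮Q⇒<Φ (⊆C x x∈X) y<x y≮Qx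

    inSupp : InSupp P Q Φ
    inSupp X = isBlockIdeal⇒JQ ∘ μΔ-J⇒isBlockIdeal , isBlockIdeal⇒μΔ-J ∘ JQ⇒isBlockIdeal

proposition4p5 : ∀ {n m} (P : FinPoset n) (Q : Fracturing n) → Good P Q →
    (Φ : Fin n → Fin m) → IsSetComposition Φ →
    (InSupp P Q Φ → Conditions P Q Φ) × (Conditions P Q Φ → InSupp P Q Φ)
proposition4p5 P Q _ Φ _ = FromSupport.conditions , FromConditions.inSupp
  where open Support P Q Φ
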